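{- Let $G$ be a fork-free graph and $I$ an independent set of $G$ such that no vertex of $G$ is adjacent to three or more vertices of $I$. Let $u$ be an $I$-free vertex, $v\in I$, and $P=u_1,u_2,\dots,u_\ell$ a shortest path from $u=u_1$ to $v=u_\ell$ in $G$. If $P$ has length at least three, then no two distinct vertices of $N[V(P)]\cap I$ have the same leftmost neighbor on $P$.
   Context: A vertex $u$ is $I$-free if $u\notin I$ and $I\cup\{u\}$ is independent. The length of a path is its number of edges. $N[V(P)]$ is the closed neighborhood of $V(P)$ (vertices of $P$ together with their neighbors). For a vertex $x$ with a neighbor on $P$, the leftmost neighbor of $x$ on $P$ is the vertex $u_i\in V(P)\cap N(x)$ with smallest index $i$. A fork is the claw with one edge subdivided once. -}

module Defs where

open import Data.Nat using (ℕ; zero; suc; _<_)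
open import Data.Fin using (Fin; zero; suc; inject₁; fromℕ) renaming (_<_ to _<ᶠ_)
open import Data.Fin.Subset using (Subset; _∈_; _∉_)
open import Data.Product using (Σ; _×_; ∃; _,_)
open import Data.Sum using (_⊎_)
open import Data.Empty using (⊥)
open import Data.Unit using (⊤)
open import Relation.Nullary using (¬_; Dec)
open import Relation.Binary.PropositionalEquality using (_≡_; _≢_)
open import Function.Bundles using (_⇔_)
open import Function.Definitions using (Injective)

record Graph : Set₁ where
  field
    n       : ℕ
    Adj     : Fin n → Fin n → Set
    adj?    : ∀ x y → Dec (Adj x y)
    sym     : ∀ {x y} → Adj x y → Adj y x
    irrefl  : ∀ {x} → ¬ Adj x x

open Graph public

-- The fork: claw with center 0, leaves 1,2,3, and edge 3–4 (subdivided edge).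
ForkEdge : Fin 5 → Fin 5 → Set
ForkEdge i j = FE i j ⊎ FE j i
  where
  FE : Fin 5 → Fin 5 → Set
  FE zero (suc zero) = ⊤
  FE zero (suc (suc zero)) = ⊤
  FE zero (suc (suc (suc zero))) = ⊤
  FE (suc (suc (suc zero))) (suc (suc (suc (suc zero)))) = ⊤
  FE _ _ = ⊥

HasInducedFork : Graph → Set
HasInducedFork G =
  Σ (Fin 5 → Fin (n G)) λ f →
    Injective _≡_ _≡_ f × (∀ i j → Adj G (f i) (f j) ⇔ ForkEdge i j)

ForkFree : Graph → Set
ForkFree G = ¬ HasInducedFork G

Independent : (G : Graph) → Subset (n G) → Set
Independent G I = ∀ x y → x ∈ I → y ∈ I → ¬ Adj G x y

AtMostTwoNbrsIn : (G : Graph) → Subset (n G) → Set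
AtMostTwoNbrsIn G I =
  ∀ x a b c → a ∈ I → b ∈ I → c ∈ I → a ≢ b → a ≢ c → b ≢ c →
    Adj G x a → Adj G x b → Adj G x c → ⊥

IFree : (G : Graph) → Subset (n G) → Fin (n G) → Set
IFree G I u = u ∉ I × (∀ w → w ∈ I → ¬ Adj G u w)

-- A path of length k (k edges) given by its vertex sequence u_0 … u_k.
record Path (G : Graph) (k : ℕ) (x y : Fin (n G)) : Set where
  field
    vtx      : Fin (suc k) → Fin (n G)
    distinct : Injective _≡_ _≡_ vtx
    steps    : ∀ (i : Fin k) → Adj G (vtx (inject₁ i)) (vtx (suc i))
    start    : vtx zero ≡ x
    end      : vtx (fromℕ k) ≡ y

open Path public

ShortestPath : (G : Graph) (k : ℕ) (x y : Fin (n G)) → Path G k x y → Set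
ShortestPath G k x y P = ∀ m → m < k → ¬ Path G m x y

InClosedNbhd : {G : Graph} {k : ℕ} {x y : Fin (n G)} → Path G k x y → Fin (n G) → Set
InClosedNbhd {G} P z = ∃ λ i → vtx P i ≡ z ⊎ Adj G z (vtx P i)

LeftmostNbr : {G : Graph} {k : ℕ} {x y : Fin (n G)} → Path G k x y → Fin (n G) → Fin (suc k) → Set
LeftmostNbr {G} P z i = Adj G z (vtx P i) × (∀ j → j <ᶠ i → ¬ Adj G z (vtx P j))

{-# OPTIONS --safe #-}
-- Let x ≠ y in I share the leftmost neighbour P_a on the shortest path P = P_0 … P_k. Every walk
-- shortens to a path, so no walk from u to v is shorter than P; hence P has no chords and no vertex
-- sees two vertices of P at distance three or more. If a = 0, x is adjacent to the I-free vertex u.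
-- If a ≥ 2, then P_a, x, y, P_{a-1}, P_{a-2} induce a fork. If a = 1, each of x, y sees P_2 or P_3
-- (otherwise it forms a fork with P_1, P_0, P_2, P_3), and x sees P_3 iff y does (otherwise
-- P_1, P_0, x, y, P_3 form a fork). If both see P_3 then k > 3, as P_3 = v would be adjacent to x;
-- otherwise both see P_2 but not P_3. Either way x and y share a neighbour P_b (b = 3 or 2) and
-- miss P_{b+1}, so either P_{b+1} = v and P_b has three neighbours x, y, v in I, or P_b, x, y,
-- P_{b+1}, P_{b+2} induce a fork.

module Submission where

open import Defs
open import Data.Nat using (ℕ; zero; suc; _≤_; _<_; _+_; _∸_; z≤n; s≤s)
open import Data.Nat.Properties
  using (≤-refl; ≤-trans; ≤-pred; <⇒≤; <⇒≱; ≮⇒≥; ≤-<-trans; n≤1+n; m≤n⇒m≤1+n; m≤n⇒m<n∨m≡n; m≤n+m; m+n≤o⇒n≤o;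
         m∸n≤m; +-comm; +-assoc; +-suc; +-cancelʳ-≤; m≤n⇒∃[o]m+o≡n)
open import Data.Fin using (Fin; zero; suc; toℕ; inject₁; fromℕ)
open import Data.Fin.Properties using (suc-injective; _≟_; any?; toℕ<n)
open import Data.Fin.Subset using (Subset; _∈_)
open import Data.Product using (_×_; ∃₂; _,_; proj₁; proj₂)
open import Relation.Nullary using (¬_; yes; no)
open import Data.Empty using (⊥; ⊥-elim)
open import Function using (_∘_)
open import Function.Bundles using (_⇔_; mk⇔)
open import Data.Fin.Patterns using (0F; 1F; 2F; 3F; 4F)
open import Data.Sum using (_⊎_; inj₁; inj₂; [_,_])
open import Data.Unit using (⊤; tt)
open import Relation.Binary.PropositionalEquality as ≡ using (_≡_; _≢_; refl; trans; cong; subst; subst₂)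
open import Function.Definitions using (Injective)

infixr 5 _∷_
data Walk (G : Graph) : Fin (n G) → Fin (n G) → ℕ → Set where
  []  : ∀ {x} → Walk G x x 0
  _∷_ : ∀ {x y z l} → Adj G x y → Walk G y z l → Walk G x z (suc l)

module _ {G : Graph} where

  infixr 5 _++_
  infixl 5 _∷ʳ_

  _++_ : ∀ {x y z l m} → Walk G x y l → Walk G y z m → Walk G x z (l + m)
  []      ++ w′ = w′
  (e ∷ w) ++ w′ = e ∷ (w ++ w′)

  _∷ʳ_ : ∀ {x y z l} → Walk G x y l → Adj G y z → Walk G x z (suc l)
  []       ∷ʳ e = e ∷ []
  (e′ ∷ w) ∷ʳ e = e′ ∷ (w ∷ʳ e)

  vertex : ∀ {x y l} → Walk G x y l → Fin (suc l) → Fin (n G)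
  vertex {x = x} _ zero    = x
  vertex (_ ∷ w)   (suc i) = vertex w i

  vertex-last : ∀ {x y l} (w : Walk G x y l) → vertex w (fromℕ l) ≡ y
  vertex-last []      = refl
  vertex-last (_ ∷ w) = vertex-last w

  vertex-step : ∀ {x y l} (w : Walk G x y l) (i : Fin l) →
                Adj G (vertex w (inject₁ i)) (vertex w (suc i))
  vertex-step (e ∷ _) zero    = e
  vertex-step (_ ∷ w) (suc i) = vertex-step w i

  Simple : ∀ {x y l} → Walk G x y l → Set
  Simple w = Injective _≡_ _≡_ (vertex w)

  simple⇒path : ∀ {x y l} (w : Walk G x y l) → Simple w → Path G l x y
  simple⇒path w simple = record
    { vtx = vertex w ; distinct = simple ; steps = vertex-step w ; start = refl ; end = vertex-last w }

  simple-[] : ∀ {v} → Simple ([] {x = v})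
  simple-[] {x = zero} {zero} _ = refl

  simple-∷ : ∀ {x y z l} (e : Adj G x y) {w : Walk G y z l} →
             Simple w → (∀ i → vertex w i ≢ x) → Simple (e ∷ w)
  simple-∷ e simple x∉w {zero}  {zero}  _  = refl
  simple-∷ e simple x∉w {zero}  {suc j} eq = ⊥-elim (x∉w j (≡.sym eq))
  simple-∷ e simple x∉w {suc i} {zero}  eq = ⊥-elim (x∉w i eq)
  simple-∷ e simple x∉w {suc i} {suc j} eq = cong suc (simple eq)

  dropUntil : ∀ {x y z l} (w : Walk G x y l) (i : Fin (suc l)) → vertex w i ≡ z →
              Walk G z y (l ∸ toℕ i)
  dropUntil w       zero    refl = w
  dropUntil (_ ∷ w) (suc i) eq   = dropUntil w i eq

  dropUntil-simple : ∀ {x y z l} (w : Walk G x y l) (i : Fin (suc l)) (eq : vertex w i ≡ z) →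
                     Simple w → Simple (dropUntil w i eq)
  dropUntil-simple w       zero    refl simple = simple
  dropUntil-simple (_ ∷ w) (suc i) eq   simple = dropUntil-simple w i eq (suc-injective ∘ simple)

  shorten : ∀ {x y l} → Walk G x y l → ∃₂ λ m (w : Walk G x y m) → m ≤ l × Simple w
  shorten [] = 0 , [] , z≤n , simple-[]
  shorten {x = x} (e ∷ w) with shorten w
  ... | m , w′ , m≤l , simple with any? (λ i → vertex w′ i ≟ x)
  ...   | yes (i , wᵢ≡x) = m ∸ toℕ i , dropUntil w′ i wᵢ≡x ,
                           m≤n⇒m≤1+n (≤-trans (m∸n≤m m (toℕ i)) m≤l) , dropUntil-simple w′ i wᵢ≡x simple
  ...   | no  x∉w′       = suc m , e ∷ w′ , s≤s m≤l , simple-∷ e simple (λ i eq → x∉w′ (i , eq))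

  shortestPath-≤-walk : ∀ {x y k l} (P : Path G k x y) → ShortestPath G k x y P → Walk G x y l → k ≤ l
  shortestPath-≤-walk _ shortest w with shorten w
  ... | m , w′ , m≤l , simple = ≮⇒≥ λ l<k → shortest m (≤-<-trans m≤l l<k) (simple⇒path w′ simple)

module _ {G : Graph} where

  adjacent⇒≢ : ∀ {a b} → Adj G a b → a ≢ b
  adjacent⇒≢ ab refl = irrefl G ab

  separated⇒≢ : ∀ {a b z} → Adj G a z → ¬ Adj G b z → a ≢ b
  separated⇒≢ az ¬bz refl = ¬bz az

  induced-fork : (c l₁ l₂ l₃ t : Fin (n G)) → l₁ ≢ l₂ →
                 Adj G c l₁ → Adj G c l₂ → Adj G c l₃ → Adj G l₃ t → ¬ Adj G c t →
                 ¬ Adj G l₁ l₂ → ¬ Adj G l₁ l₃ → ¬ Adj G l₁ t → ¬ Adj G l₂ l₃ → ¬ Adj G l₂ t →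
                 HasInducedFork G
  induced-fork c l₁ l₂ l₃ t l₁≢l₂ cl₁ cl₂ cl₃ l₃t ¬ct ¬l₁l₂ ¬l₁l₃ ¬l₁t ¬l₂l₃ ¬l₂t =
    fork , fork-injective , fork-adjacency
    where
    fork : Fin 5 → Fin (n G)
    fork 0F = c
    fork 1F = l₁
    fork 2F = l₂
    fork 3F = l₃
    fork 4F = t

    edge : ∀ {a b} {B : Set} → Adj G a b → Adj G a b ⇔ (⊤ ⊎ B)
    edge ab = mk⇔ (λ _ → inj₁ tt) (λ _ → ab)

    edgeᵒ : ∀ {a b} {A : Set} → Adj G b a → Adj G a b ⇔ (A ⊎ ⊤)
    edgeᵒ ba = mk⇔ (λ _ → inj₂ tt) (λ _ → sym G ba)

    nonEdge : ∀ {a b} → ¬ Adj G a b → Adj G a b ⇔ (⊥ ⊎ ⊥)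
    nonEdge ¬ab = mk⇔ (⊥-elim ∘ ¬ab) [ ⊥-elim , ⊥-elim ]

    nonEdgeᵒ : ∀ {a b} → ¬ Adj G b a → Adj G a b ⇔ (⊥ ⊎ ⊥)
    nonEdgeᵒ ¬ba = nonEdge (¬ba ∘ sym G)

    loop : ∀ {a} → Adj G a a ⇔ (⊥ ⊎ ⊥)
    loop = nonEdge (irrefl G)

    fork-adjacency : ∀ i j → Adj G (fork i) (fork j) ⇔ ForkEdge i j
    fork-adjacency 0F 0F = loop
    fork-adjacency 0F 1F = edge cl₁
    fork-adjacency 0F 2F = edge cl₂
    fork-adjacency 0F 3F = edge cl₃
    fork-adjacency 0F 4F = nonEdge ¬ct
    fork-adjacency 1F 0F = edgeᵒ cl₁
    fork-adjacency 1F 1F = loop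
    fork-adjacency 1F 2F = nonEdge ¬l₁l₂
    fork-adjacency 1F 3F = nonEdge ¬l₁l₃
    fork-adjacency 1F 4F = nonEdge ¬l₁t
    fork-adjacency 2F 0F = edgeᵒ cl₂
    fork-adjacency 2F 1F = nonEdgeᵒ ¬l₁l₂
    fork-adjacency 2F 2F = loop
    fork-adjacency 2F 3F = nonEdge ¬l₂l₃
    fork-adjacency 2F 4F = nonEdge ¬l₂t
    fork-adjacency 3F 0F = edgeᵒ cl₃
    fork-adjacency 3F 1F = nonEdgeᵒ ¬l₁l₃
    fork-adjacency 3F 2F = nonEdgeᵒ ¬l₂l₃
    fork-adjacency 3F 3F = loop
    fork-adjacency 3F 4F = edge l₃t
    fork-adjacency 4F 0F = nonEdgeᵒ ¬ct
    fork-adjacency 4F 1F = nonEdgeᵒ ¬l₁t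
    fork-adjacency 4F 2F = nonEdgeᵒ ¬l₂t
    fork-adjacency 4F 3F = edgeᵒ l₃t
    fork-adjacency 4F 4F = loop

    fork-injective : Injective _≡_ _≡_ fork
    fork-injective {0F} {0F} _  = refl
    fork-injective {0F} {1F} eq = ⊥-elim (adjacent⇒≢ cl₁ eq)
    fork-injective {0F} {2F} eq = ⊥-elim (adjacent⇒≢ cl₂ eq)
    fork-injective {0F} {3F} eq = ⊥-elim (adjacent⇒≢ cl₃ eq)
    fork-injective {0F} {4F} eq = ⊥-elim (separated⇒≢ cl₁ (¬l₁t ∘ sym G) eq)
    fork-injective {1F} {0F} eq = ≡.sym (fork-injective {0F} {1F} (≡.sym eq))
    fork-injective {1F} {1F} _  = refl
    fork-injective {1F} {2F} eq = ⊥-elim (l₁≢l₂ eq)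
    fork-injective {1F} {3F} eq = ⊥-elim (separated⇒≢ l₃t ¬l₁t (≡.sym eq))
    fork-injective {1F} {4F} eq = ⊥-elim (separated⇒≢ (sym G cl₁) (¬ct ∘ sym G) eq)
    fork-injective {2F} {0F} eq = ≡.sym (fork-injective {0F} {2F} (≡.sym eq))
    fork-injective {2F} {1F} eq = ≡.sym (fork-injective {1F} {2F} (≡.sym eq))
    fork-injective {2F} {2F} _  = refl
    fork-injective {2F} {3F} eq = ⊥-elim (separated⇒≢ l₃t ¬l₂t (≡.sym eq))
    fork-injective {2F} {4F} eq = ⊥-elim (separated⇒≢ (sym G cl₂) (¬ct ∘ sym G) eq)
    fork-injective {3F} {0F} eq = ≡.sym (fork-injective {0F} {3F} (≡.sym eq))
    fork-injective {3F} {1F} eq = ≡.sym (fork-injective {1F} {3F} (≡.sym eq))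
    fork-injective {3F} {2F} eq = ≡.sym (fork-injective {2F} {3F} (≡.sym eq))
    fork-injective {3F} {3F} _  = refl
    fork-injective {3F} {4F} eq = ⊥-elim (adjacent⇒≢ l₃t eq)
    fork-injective {4F} {0F} eq = ≡.sym (fork-injective {0F} {4F} (≡.sym eq))
    fork-injective {4F} {1F} eq = ≡.sym (fork-injective {1F} {4F} (≡.sym eq))
    fork-injective {4F} {2F} eq = ≡.sym (fork-injective {2F} {4F} (≡.sym eq))
    fork-injective {4F} {3F} eq = ≡.sym (fork-injective {3F} {4F} (≡.sym eq))
    fork-injective {4F} {4F} _  = refl

clamp : (k j : ℕ) → Fin (suc k)
clamp k       zero    = zero
clamp zero    (suc j) = zero
clamp (suc k) (suc j) = suc (clamp k j)

toℕ-clamp : ∀ {k j} → j ≤ k → toℕ (clamp k j) ≡ j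
toℕ-clamp {j = zero}  _         = refl
toℕ-clamp {j = suc j} (s≤s j≤k) = cong suc (toℕ-clamp j≤k)

clamp-toℕ : ∀ k (i : Fin (suc k)) → clamp k (toℕ i) ≡ i
clamp-toℕ k       zero    = refl
clamp-toℕ (suc k) (suc i) = cong suc (clamp-toℕ k i)

clamp-inject₁ : ∀ {k j} → j ≤ k → clamp (suc k) j ≡ inject₁ (clamp k j)
clamp-inject₁ {j = zero}  _         = refl
clamp-inject₁ {j = suc j} (s≤s j≤k) = cong suc (clamp-inject₁ j≤k)

clamp-fromℕ : ∀ k → clamp k k ≡ fromℕ k
clamp-fromℕ zero    = refl
clamp-fromℕ (suc k) = cong suc (clamp-fromℕ k)

module AlongPath {G : Graph} {k : ℕ} {u v : Fin (n G)} (P : Path G k u v) where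

  -- Indices beyond k are clamped to k; every lemma below only looks at P[ j ] with j ≤ k.
  P[_] : ℕ → Fin (n G)
  P[ j ] = vtx P (clamp k j)

  P-start : P[ 0 ] ≡ u
  P-start = start P

  P-end : P[ k ] ≡ v
  P-end = trans (cong (vtx P) (clamp-fromℕ k)) (end P)

  P-step : ∀ {j} → j < k → Adj G P[ j ] P[ suc j ]
  P-step {j} (s≤s j≤k′) =
    subst (λ i → Adj G (vtx P i) P[ suc j ]) (≡.sym (clamp-inject₁ j≤k′)) (steps P (clamp _ j))

  prefix : ∀ {a} → a ≤ k → Walk G u P[ a ] a
  prefix {zero}  _   = subst (λ s → Walk G s P[ 0 ] 0) P-start []
  prefix {suc a} a<k = prefix (<⇒≤ a<k) ∷ʳ P-step a<k

  suffix : ∀ {b} r → r + b ≡ k → Walk G P[ b ] v r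
  suffix zero    refl = subst (λ t → Walk G P[ k ] t 0) P-end []
  suffix {b} (suc r) 1+r+b≡k =
    P-step (subst (b <_) 1+r+b≡k (s≤s (m≤n+m b r))) ∷ suffix r (trans (+-suc r b) 1+r+b≡k)

  LeftmostAt : Fin (n G) → ℕ → Set
  LeftmostAt w a = Adj G w P[ a ] × (∀ b → b < a → ¬ Adj G w P[ b ])

  leftmostNbr⇒leftmostAt : ∀ {w i} → LeftmostNbr P w i → LeftmostAt w (toℕ i)
  leftmostNbr⇒leftmostAt {w} {i} (wᵢ , left) =
      subst (λ j → Adj G w (vtx P j)) (≡.sym (clamp-toℕ k i)) wᵢ
    , λ b b<i → left (clamp k b) (subst (_< toℕ i) (≡.sym (toℕ-clamp (≤-trans (<⇒≤ b<i) i≤k))) b<i)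
    where
    i≤k : toℕ i ≤ k
    i≤k = ≤-pred (toℕ<n i)

module AlongShortestPath {G : Graph} {k : ℕ} {u v : Fin (n G)}
                         (P : Path G k u v) (shortest : ShortestPath G k u v P) where

  open AlongPath P public

  subpath-shortest : ∀ {a b m} → a ≤ k → b ≤ k → Walk G P[ a ] P[ b ] m → b ≤ m + a
  subpath-shortest {a} {b} {m} a≤k b≤k w with m≤n⇒∃[o]m+o≡n b≤k
  ... | r , b+r≡k = +-cancelʳ-≤ r b (m + a) (subst₂ _≤_ (≡.sym b+r≡k) rearrange k≤detour)
    where
    k≤detour : k ≤ a + (m + r)
    k≤detour = shortestPath-≤-walk P shortest (prefix a≤k ++ w ++ suffix r (trans (+-comm r b) b+r≡k))
    rearrange : a + (m + r) ≡ (m + a) + r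
    rearrange = trans (≡.sym (+-assoc a m r)) (cong (_+ r) (+-comm a m))

  chordless : ∀ {a b} → suc a < b → b ≤ k → ¬ Adj G P[ a ] P[ b ]
  chordless a+1<b b≤k e = <⇒≱ a+1<b (subpath-shortest (≤-trans (m+n≤o⇒n≤o 2 a+1<b) b≤k) b≤k (e ∷ []))

  no-common-neighbour : ∀ {a b w} → suc (suc a) < b → b ≤ k → Adj G w P[ a ] → ¬ Adj G w P[ b ]
  no-common-neighbour a+2<b b≤k wa wb =
    <⇒≱ a+2<b (subpath-shortest (≤-trans (m+n≤o⇒n≤o 3 a+2<b) b≤k) b≤k (sym G wa ∷ wb ∷ []))

module SharedLeftmostNeighbour
  (G : Graph) (forkFree : ForkFree G) (I : Subset (n G))
  (independent : Independent G I) (atMostTwo : AtMostTwoNbrsIn G I)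
  {u v : Fin (n G)} (uFree : IFree G I u) (v∈I : v ∈ I)
  {k : ℕ} (P : Path G k u v) (shortest : ShortestPath G k u v P) (3≤k : 3 ≤ k)
  {x y : Fin (n G)} (x∈I : x ∈ I) (y∈I : y ∈ I) (x≢y : x ≢ y) where

  open AlongShortestPath P shortest

  ¬start-adjacent : ∀ {w} → w ∈ I → ¬ Adj G P[ 0 ] w
  ¬start-adjacent w∈I = proj₂ uFree _ w∈I ∘ subst (λ s → Adj G s _) P-start

  start-≢ : ∀ {w} → w ∈ I → P[ 0 ] ≢ w
  start-≢ w∈I eq = proj₁ uFree (subst (_∈ I) (≡.sym (trans (≡.sym P-start) eq)) w∈I)

  module _ {w : Fin (n G)} (w₁ : Adj G w P[ 1 ]) where

    ¬far-adjacent : ∀ {c} → 4 ≤ c → c ≤ k → ¬ Adj G w P[ c ]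
    ¬far-adjacent 4≤c c≤k = no-common-neighbour 4≤c c≤k w₁

    ≢-beyond : ∀ {c} → 3 ≤ c → c ≤ k → w ≢ P[ c ]
    ≢-beyond 3≤c c≤k refl = chordless 3≤c c≤k (sym G w₁)

  ¬misses-P₂-and-P₃ : ∀ {w} → w ∈ I → Adj G w P[ 1 ] → ¬ Adj G w P[ 2 ] → ¬ Adj G w P[ 3 ] → ⊥
  ¬misses-P₂-and-P₃ w∈I w₁ ¬w₂ ¬w₃ =
    forkFree (induced-fork {G} P[ 1 ] P[ 0 ] _ P[ 2 ] P[ 3 ] (start-≢ w∈I)
      (sym G (P-step (≤-trans (s≤s z≤n) 3≤k))) (sym G w₁) (P-step (<⇒≤ 3≤k)) (P-step 3≤k)
      (chordless ≤-refl 3≤k) (¬start-adjacent w∈I) (chordless ≤-refl (<⇒≤ 3≤k))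
      (chordless (s≤s (s≤s z≤n)) 3≤k) ¬w₂ ¬w₃)

  ¬only-one-sees-P₃ : ∀ {w w′} → w ∈ I → w′ ∈ I → Adj G w P[ 1 ] → Adj G w′ P[ 1 ] →
                       Adj G w P[ 3 ] → ¬ Adj G w′ P[ 3 ] → ⊥
  ¬only-one-sees-P₃ w∈I w′∈I w₁ w′₁ w₃ ¬w′₃ =
    forkFree (induced-fork {G} P[ 1 ] P[ 0 ] _ _ P[ 3 ] (start-≢ w′∈I)
      (sym G (P-step (≤-trans (s≤s z≤n) 3≤k))) (sym G w′₁) (sym G w₁) w₃
      (chordless ≤-refl 3≤k) (¬start-adjacent w′∈I) (¬start-adjacent w∈I) (chordless (s≤s (s≤s z≤n)) 3≤k)
      (independent _ _ w′∈I w∈I) ¬w′₃)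

  module _ (x₁ : Adj G x P[ 1 ]) (y₁ : Adj G y P[ 1 ]) where

    ¬shared-without-successor : ∀ {b} → 2 ≤ b → b < k → Adj G x P[ b ] → Adj G y P[ b ] →
                                ¬ Adj G x P[ suc b ] → ¬ Adj G y P[ suc b ] → ⊥
    ¬shared-without-successor {b} 2≤b b<k x_b y_b ¬x_b+1 ¬y_b+1 with m≤n⇒m<n∨m≡n b<k
    ... | inj₂ b+1≡k =
      atMostTwo P[ b ] x y P[ suc b ] x∈I y∈I (subst (_∈ I) (≡.sym (trans (cong P[_] b+1≡k) P-end)) v∈I)
        x≢y (≢-beyond x₁ (s≤s 2≤b) b<k) (≢-beyond y₁ (s≤s 2≤b) b<k) (sym G x_b) (sym G y_b) (P-step b<k)
    ... | inj₁ b+1<k =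
      forkFree (induced-fork {G} P[ b ] x y P[ suc b ] P[ suc (suc b) ] x≢y
        (sym G x_b) (sym G y_b) (P-step b<k) (P-step b+1<k) (chordless ≤-refl b+1<k)
        (independent x y x∈I y∈I) ¬x_b+1 (¬far-adjacent x₁ (s≤s (s≤s 2≤b)) b+1<k)
        ¬y_b+1 (¬far-adjacent y₁ (s≤s (s≤s 2≤b)) b+1<k))

    ¬shared-leftmost-P₁ : ⊥
    ¬shared-leftmost-P₁ with adj? G x P[ 3 ] | adj? G y P[ 3 ]
    ... | yes x₃ | no ¬y₃ = ¬only-one-sees-P₃ x∈I y∈I x₁ y₁ x₃ ¬y₃
    ... | no ¬x₃ | yes y₃ = ¬only-one-sees-P₃ y∈I x∈I y₁ x₁ y₃ ¬x₃
    ... | yes x₃ | yes y₃ with m≤n⇒m<n∨m≡n 3≤k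
    ...   | inj₁ 3<k = ¬shared-without-successor (s≤s (s≤s z≤n)) 3<k x₃ y₃
                           (¬far-adjacent x₁ ≤-refl 3<k) (¬far-adjacent y₁ ≤-refl 3<k)
    ...   | inj₂ 3≡k = independent x v x∈I v∈I (subst (Adj G x) (trans (cong P[_] 3≡k) P-end) x₃)
    ¬shared-leftmost-P₁ | no ¬x₃ | no ¬y₃ with adj? G x P[ 2 ] | adj? G y P[ 2 ]
    ... | yes x₂ | yes y₂ = ¬shared-without-successor ≤-refl 3≤k x₂ y₂ ¬x₃ ¬y₃
    ... | no ¬x₂ | _      = ¬misses-P₂-and-P₃ x∈I x₁ ¬x₂ ¬x₃
    ... | _      | no ¬y₂ = ¬misses-P₂-and-P₃ y∈I y₁ ¬y₂ ¬y₃

  ¬shared-leftmost-beyond-P₁ : ∀ {a} → 2 + a ≤ k → LeftmostAt x (2 + a) → LeftmostAt y (2 + a) → ⊥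
  ¬shared-leftmost-beyond-P₁ {a} a+2≤k (x_a+2 , x-left) (y_a+2 , y-left) =
    forkFree (induced-fork {G} P[ 2 + a ] x y P[ 1 + a ] P[ a ] x≢y
      (sym G x_a+2) (sym G y_a+2) (sym G (P-step a+2≤k)) (sym G (P-step a<k))
      (chordless ≤-refl a+2≤k ∘ sym G) (independent x y x∈I y∈I)
      (x-left (1 + a) ≤-refl) (x-left a (n≤1+n _)) (y-left (1 + a) ≤-refl) (y-left a (n≤1+n _)))
    where
    a<k : a < k
    a<k = <⇒≤ a+2≤k

  no-shared-leftmost : ∀ a → a ≤ k → LeftmostAt x a → LeftmostAt y a → ⊥
  no-shared-leftmost 0             _     (x₀ , _) _        = ¬start-adjacent x∈I (sym G x₀)
  no-shared-leftmost 1             _     (x₁ , _) (y₁ , _) = ¬shared-leftmost-P₁ x₁ y₁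
  no-shared-leftmost (suc (suc a)) a+2≤k xₐ yₐ       = ¬shared-leftmost-beyond-P₁ a+2≤k xₐ yₐ

lemma6p8 : (G : Graph) → ForkFree G → (I : Subset (n G)) → Independent G I → AtMostTwoNbrsIn G I →
    (u v : Fin (n G)) → IFree G I u → v ∈ I →
    (k : ℕ) (P : Path G k u v) → ShortestPath G k u v P → 3 ≤ k →
    ∀ (x y : Fin (n G)) → x ∈ I → y ∈ I → x ≢ y → InClosedNbhd P x → InClosedNbhd P y →
    ∀ (i j : Fin _) → LeftmostNbr P x i → LeftmostNbr P y j → i ≢ j
-- Membership in N[V(P)] is implied by having a leftmost neighbour.
lemma6p8 G forkFree I independent atMostTwo u v uFree v∈I k P shortest 3≤k x y x∈I y∈I x≢y _ _ i .i xᵢ yᵢ refl =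
  no-shared-leftmost (toℕ i) (≤-pred (toℕ<n i)) (leftmostNbr⇒leftmostAt xᵢ) (leftmostNbr⇒leftmostAt yᵢ)
  where
  open SharedLeftmostNeighbour G forkFree I independent atMostTwo uFree v∈I P shortest 3≤k x∈I y∈I x≢y
  open AlongPath P
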